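{- Let $k\ge1$ and let $\triangle(2k)$ be the $3$-valent $(2k,0)$-cluster. Then the space of $D_3$-invariant eigenfunctions of the Laplacian of $\triangle(2k)$ with eigenvalue $4$ has dimension at least $\lceil k/2\rceil$; and, for $k\ge2$, the space of $D_3$-invariant eigenfunctions of the Laplacian of $\triangle(2k)$ with eigenvalue $2$ has dimension at least $\lfloor k/2\rfloor$.
   Context: Let $\omega=e^{\pi i/3}$ and $\mathbb{Z}[\omega]$ the triangular lattice (small triangles: translates of the triangles with vertices $0,1,\omega$ and $1,1+\omega,\omega$). For $n\ge1$ the $(n,0)$-cluster $\triangle(n)$ is the graph whose $n^2$ vertices are the small triangles contained in the triangle with vertices $0,n,n\omega$, two adjacent iff they share an edge. Its Laplacian is $(\Delta f)(x)=\deg(x)f(x)-\sum_{y\sim x}f(y)$ with degrees taken in $\triangle(n)$. The dihedral group $D_3$ of symmetries of the triangle with vertices $0,n,n\omega$ acts on $\triangle(n)$ by graph automorphisms; a function $u$ on $V(\triangle(n))$ is $D_3$-invariant if $u(\sigma x)=u(x)$ for all $\sigma\in D_3$ and all vertices $x$. -}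

module Defs where

open import Data.Nat as ℕ using (ℕ; zero; suc)
open import Data.Integer using (ℤ; _+_; _-_; _*_; +_; 0ℤ)
open import Data.List using (List; []; _∷_; _++_; foldr; map)
open import Data.Fin using (Fin) renaming (zero to fz; suc to fs)
open import Data.Product using (Σ; _×_; _,_)
open import Relation.Binary.PropositionalEquality using (_≡_)

-- A lattice point x + yω of the big triangle with corners 0, n, nω has
-- (integer) barycentric coordinates (n-x-y, x, y) w.r.t. (0, n, nω).
-- * An upward small triangle (translate of {0,1,ω}) has corners
--     (i+1,j,k), (i,j+1,k), (i,j,k+1)   with  i+j+k = n-1;
--   we denote it  tri up i j k.
-- * A downward small triangle (translate of {1,1+ω,ω}) has corners
--     (i,j+1,k+1), (i+1,j,k+1), (i+1,j+1,k)   with  i+j+k = n-2;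
--   we denote it  tri down i j k.
-- These are exactly the n(n+1)/2 + n(n-1)/2 = n² vertices of △(n).

data Ori : Set where
  up down : Ori

record Tri : Set where
  constructor tri
  field
    ori : Ori
    i j k : ℕ

Valid : ℕ → Tri → Set
Valid n (tri up i j k)   = suc (i ℕ.+ j ℕ.+ k) ≡ n
Valid n (tri down i j k) = suc (suc (i ℕ.+ j ℕ.+ k)) ≡ n

-- A downward
-- triangle (i,j,k) shares its three edges with the upward triangles
-- (i+1,j,k), (i,j+1,k), (i,j,k+1) (always inside the big triangle); an
-- upward triangle (i,j,k) shares edges with the downward triangles
-- (i-1,j,k), (i,j-1,k), (i,j,k-1) whenever these exist.
private
  predTri : ℕ → (ℕ → Tri) → List Tri
  predTri zero    g = []
  predTri (suc m) g = g m ∷ []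

nbrs : Tri → List Tri
nbrs (tri up i j k) =
  predTri i (λ i' → tri down i' j k) ++
  predTri j (λ j' → tri down i j' k) ++
  predTri k (λ k' → tri down i j k')
nbrs (tri down i j k) =
  tri up (suc i) j k ∷ tri up i (suc j) k ∷ tri up i j (suc k) ∷ []

sumℤ : List ℤ → ℤ
sumℤ = foldr _+_ 0ℤ

Δ : (Tri → ℤ) → Tri → ℤ
Δ f x = sumℤ (map (λ y → f x - f y) (nbrs x))

-- The dihedral group D₃ of the big triangle = all permutations of its
-- corners = all permutations of barycentric coordinates.

data D₃ : Set where
  e r r² s sr sr² : D₃

perm : D₃ → ℕ → ℕ → ℕ → ℕ × ℕ × ℕ
perm e   a b c = a , b , c
perm r   a b c = c , a , b
perm r²  a b c = b , c , a
perm s   a b c = b , a , c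
perm sr  a b c = a , c , b
perm sr² a b c = c , b , a

act : D₃ → Tri → Tri
act σ (tri o a b c) with perm σ a b c
... | (a' , b' , c') = tri o a' b' c'

-- Properties of functions on the vertices of △(n) (values outside the
-- valid vertices are irrelevant).

Invariant : ℕ → (Tri → ℤ) → Set
Invariant n u = ∀ (σ : D₃) (x : Tri) → Valid n x → u (act σ x) ≡ u x

EigenFn : ℕ → ℤ → (Tri → ℤ) → Set
EigenFn n λ′ u = ∀ (x : Tri) → Valid n x → Δ u x ≡ λ′ * u x

lincomb : ∀ {m} → (Fin m → ℤ) → (Fin m → Tri → ℤ) → Tri → ℤ
lincomb {zero}  c u x = 0ℤ
lincomb {suc m} c u x = c fz * u fz x + lincomb (λ t → c (fs t)) (λ t → u (fs t)) x

LinIndep : ℕ → ∀ {m} → (Fin m → Tri → ℤ) → Set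
LinIndep n {m} u =
  ∀ (c : Fin m → ℤ) → (∀ (x : Tri) → Valid n x → lincomb c u x ≡ 0ℤ) →
  ∀ (t : Fin m) → c t ≡ 0ℤ

-- "the space of D₃-invariant eigenfunctions of Δ on △(n) with eigenvalue
--  λ has dimension ≥ m": there are m linearly independent such functions.
-- (Since Δ and the D₃-action are given by integer matrices, the real
-- solution space has a rational, hence integral, basis; so it suffices
-- and is equivalent to use ℤ-valued functions and ℤ-coefficients.)
InvEigenDimAtLeast : ℕ → ℤ → ℕ → Set
InvEigenDimAtLeast n λ′ m =
  Σ (Fin m → Tri → ℤ) λ u →
    (∀ t → Invariant n (u t)) × (∀ t → EigenFn n λ′ (u t)) × LinIndep n u

{-# OPTIONS --safe #-}
-- For φ : ℕ → ℤ let S(a,b,c) = Σ φ(x)(−1)^y over the ordered pairs (x, y) of distinct entries of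
-- (a,b,c), and put u = S(i,j,k) on the upward triangle (i,j,k) and u = −σ S(i+1,j+1,k+1) on the
-- downward one.  S is symmetric, so u is D₃-invariant.  The neighbours of a triangle sit at the
-- shifts (a,b,c) + ε, ε ∈ {0,1}³, of one parity of |ε|, and since (−1)^(y+1) = −(−1)^y, S summed
-- over such a coset vanishes; with σ² = 1 this is Δu = (3 − σ)u, as long as each boundary triangle
-- takes the same value as its missing (ghost) neighbour would.  For n even that holds as soon as
-- φ(n − x) = −σ φ(x).  The profiles φ = δ_ρ − σ δ_(n−ρ) with ρ odd and 2ρ ≤ n = 2k give
-- eigenfunctions for 4 (σ = −1) and 2 (σ = 1), whose values 2φ(ρ′) at the boundary triangles
-- (0, ρ′, n − 1 − ρ′) form a diagonal matrix with diagonal 2(1 − σ[2ρ = n]).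
module Submission where

open import Defs
open import Data.Nat using (ℕ; _*_; _≤_; ⌈_/2⌉; ⌊_/2⌋)
open import Data.Integer using (+_)
open import Data.Product using (_×_)

open import Data.Bool using (if_then_else_)
open import Data.Fin using (Fin; toℕ)
import Data.Fin.Properties as Fin
open import Data.Integer as ℤ using (ℤ; 0ℤ; 1ℤ; -1ℤ; _+_; _-_; -_; _^_)
  renaming (_*_ to _·_)
import Data.Integer.Properties as ℤ
open import Algebra.Properties.CommutativeSemigroup ℤ.+-commutativeSemigroup
  using (xy∙z≈yz∙x)
open import Data.Integer.Tactic.RingSolver using (solve-∀)
open import Data.Nat as ℕ using (zero; suc; _<_; _∸_)
import Data.Nat.Properties as ℕ
open import Data.Product using (_,_)
open import Data.Sum using (_⊎_; inj₁; inj₂; map₂)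
open import Function using (_∘_; _⇔_; mk⇔; Equivalence)
open import Relation.Binary.PropositionalEquality
open import Relation.Nullary using (yes; no; does; contradiction)
open import Relation.Nullary.Decidable using (dec-true; dec-false)

-1^-even : ∀ m → -1ℤ ^ (2 * m) ≡ 1ℤ
-1^-even m = trans (sym (ℤ.^-*-assoc -1ℤ 2 m)) (ℤ.^-zeroˡ m)

-1^-square : ∀ m → -1ℤ ^ m · -1ℤ ^ m ≡ 1ℤ
-1^-square zero    = refl
-1^-square (suc m) = trans (negate-both (-1ℤ ^ m)) (-1^-square m)
  where
  negate-both : ∀ u → (-1ℤ · u) · (-1ℤ · u) ≡ u · u
  negate-both = solve-∀

-1^-opposite : ∀ {b c} → -1ℤ ^ suc (b ℕ.+ c) ≡ 1ℤ → -1ℤ ^ b + -1ℤ ^ c ≡ 0ℤ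
-1^-opposite {b} {c} odd = begin
  u + v                                           ≡⟨ rearrange u v ⟩
  u · (1ℤ - v · v) + v · (1ℤ - -1ℤ · (u · v))     ≡⟨ cong₂ (λ x y → u · (1ℤ - x) + v · (1ℤ - y))
                                                       (-1^-square c) uv≡-1 ⟩
  u · 0ℤ + v · 0ℤ                                 ≡⟨ annihilate u v ⟩
  0ℤ                                              ∎
  where
  open ≡-Reasoning
  u v : ℤ
  u = -1ℤ ^ b
  v = -1ℤ ^ c
  uv≡-1 : -1ℤ · (u · v) ≡ 1ℤ
  uv≡-1 = trans (cong (-1ℤ ·_) (sym (ℤ.^-distribˡ-+-* -1ℤ b c))) odd
  rearrange : ∀ u v → u + v ≡ u · (1ℤ - v · v) + v · (1ℤ - -1ℤ · (u · v))
  rearrange = solve-∀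
  annihilate : ∀ u v → u · 0ℤ + v · 0ℤ ≡ 0ℤ
  annihilate = solve-∀

pairSum : (ℕ → ℤ) → (ℕ → ℤ) → ℕ → ℕ → ℕ → ℤ
pairSum f h a b c = f a · (h b + h c) + f b · (h c + h a) + f c · (h a + h b)

pairSum-rotate : ∀ f h a b c → pairSum f h c a b ≡ pairSum f h a b c
pairSum-rotate f h a b c = xy∙z≈yz∙x (f c · (h a + h b)) (f a · (h b + h c)) (f b · (h c + h a))

pairSum-swap : ∀ f h a b c → pairSum f h b a c ≡ pairSum f h a b c
pairSum-swap f h a b c = swap (f a) (f b) (f c) (h a) (h b) (h c)
  where
  swap : ∀ x y z u v w →
    y · (u + w) + x · (w + v) + z · (v + u) ≡ x · (v + w) + y · (w + u) + z · (u + v)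
  swap = solve-∀

perm-invariant : ∀ {A : Set} (F : ℕ → ℕ → ℕ → A) →
  (∀ a b c → F c a b ≡ F a b c) → (∀ a b c → F b a c ≡ F a b c) →
  ∀ g a b c → let (a′ , b′ , c′) = perm g a b c in F a′ b′ c′ ≡ F a b c
perm-invariant F rotate swap e   a b c = refl
perm-invariant F rotate swap r   a b c = rotate a b c
perm-invariant F rotate swap r²  a b c = sym (rotate b c a)
perm-invariant F rotate swap s   a b c = swap a b c
perm-invariant F rotate swap sr  a b c = trans (swap c a b) (rotate a b c)
perm-invariant F rotate swap sr² a b c = trans (swap b c a) (sym (rotate b c a))

pairSum-symmetric : ∀ f h g a b c →
  let (a′ , b′ , c′) = perm g a b c in pairSum f h a′ b′ c′ ≡ pairSum f h a b c
pairSum-symmetric f h = perm-invariant (pairSum f h) (pairSum-rotate f h) (pairSum-swap f h)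

profileSum : (ℕ → ℤ) → ℕ → ℕ → ℕ → ℤ
profileSum φ = pairSum φ (-1ℤ ^_)

-- Over either coset each ordered pair of positions (x, y) contributes
-- (φ x + φ (x + 1)) ((−1)^y + (−1)^(y + 1)) = 0.
profileSum-evenShifts : ∀ φ a b c →
  profileSum φ a b c + profileSum φ a (suc b) (suc c) +
  profileSum φ (suc a) b (suc c) + profileSum φ (suc a) (suc b) c ≡ 0ℤ
profileSum-evenShifts φ a b c =
  cancel (φ a) (φ (suc a)) (φ b) (φ (suc b)) (φ c) (φ (suc c)) (-1ℤ ^ a) (-1ℤ ^ b) (-1ℤ ^ c)
  where
  cancel : ∀ x x′ y y′ z z′ p q r →
    (x · (q + r) + y · (r + p) + z · (p + q)) +
    (x · (-1ℤ · q + -1ℤ · r) + y′ · (-1ℤ · r + p) + z′ · (p + -1ℤ · q)) +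
    (x′ · (q + -1ℤ · r) + y · (-1ℤ · r + -1ℤ · p) + z′ · (-1ℤ · p + q)) +
    (x′ · (-1ℤ · q + r) + y′ · (r + -1ℤ · p) + z · (-1ℤ · p + -1ℤ · q)) ≡ 0ℤ
  cancel = solve-∀

profileSum-oddShifts : ∀ φ a b c →
  profileSum φ (suc a) (suc b) (suc c) + profileSum φ (suc a) b c +
  profileSum φ a (suc b) c + profileSum φ a b (suc c) ≡ 0ℤ
profileSum-oddShifts φ a b c =
  cancel (φ a) (φ (suc a)) (φ b) (φ (suc b)) (φ c) (φ (suc c)) (-1ℤ ^ a) (-1ℤ ^ b) (-1ℤ ^ c)
  where
  cancel : ∀ x x′ y y′ z z′ p q r →
    (x′ · (-1ℤ · q + -1ℤ · r) + y′ · (-1ℤ · r + -1ℤ · p) + z′ · (-1ℤ · p + -1ℤ · q)) +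
    (x′ · (q + r) + y · (r + -1ℤ · p) + z · (-1ℤ · p + q)) +
    (x · (-1ℤ · q + r) + y′ · (r + p) + z · (p + -1ℤ · q)) +
    (x · (q + -1ℤ · r) + y · (-1ℤ · r + p) + z′ · (p + q)) ≡ 0ℤ
  cancel = solve-∀

Skew : ℕ → ℤ → (ℕ → ℤ) → Set
Skew n σ φ = ∀ x y → x ℕ.+ y ≡ n → φ x + σ · φ y ≡ 0ℤ

-- The two sides differ by a combination of (−1)^b + (−1)^c and the skew relations at (b, c + 1)
-- and (c, b + 1).
profileSum-boundary : ∀ {n σ φ} → -1ℤ ^ n ≡ 1ℤ → Skew n σ φ → ∀ b c → suc (b ℕ.+ c) ≡ n →
  profileSum φ 0 b c ≡ - σ · profileSum φ 0 (suc b) (suc c)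
profileSum-boundary {n} {σ} {φ} n-even skew b c b+c+1≡n = begin
  profileSum φ 0 b c
    ≡⟨ split (φ 0) (φ b) (φ c) (φ (suc b)) (φ (suc c)) (-1ℤ ^ b) (-1ℤ ^ c) σ ⟩
  - σ · ghost + defect  ≡⟨ cong (_+_ (- σ · ghost)) defect≡0 ⟩
  - σ · ghost + 0ℤ      ≡⟨ ℤ.+-identityʳ (- σ · ghost) ⟩
  - σ · ghost           ∎
  where
  open ≡-Reasoning
  ghost defect : ℤ
  ghost = profileSum φ 0 (suc b) (suc c)
  defect = (-1ℤ ^ b + -1ℤ ^ c) · (φ 0 - σ · φ 0 - σ · φ (suc b) - σ · φ (suc c)) +
           (1ℤ + -1ℤ ^ c) · (φ b + σ · φ (suc c)) + (1ℤ + -1ℤ ^ b) · (φ c + σ · φ (suc b))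
  opposite : -1ℤ ^ b + -1ℤ ^ c ≡ 0ℤ
  opposite = -1^-opposite {b} {c} (subst (λ m → -1ℤ ^ m ≡ 1ℤ) (sym b+c+1≡n) n-even)
  skewᵇ : φ b + σ · φ (suc c) ≡ 0ℤ
  skewᵇ = skew b (suc c) (trans (ℕ.+-suc b c) b+c+1≡n)
  skewᶜ : φ c + σ · φ (suc b) ≡ 0ℤ
  skewᶜ = skew c (suc b) (trans (ℕ.+-suc c b) (trans (cong suc (ℕ.+-comm c b)) b+c+1≡n))
  split : ∀ z p q p′ q′ u v σ →
    z · (u + v) + p · (v + 1ℤ) + q · (1ℤ + u) ≡
    - σ · (z · (-1ℤ · u + -1ℤ · v) + p′ · (-1ℤ · v + 1ℤ) + q′ · (1ℤ + -1ℤ · u)) +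
    ((u + v) · (z - σ · z - σ · p′ - σ · q′) + (1ℤ + v) · (p + σ · q′) + (1ℤ + u) · (q + σ · p′))
  split = solve-∀
  defect≡0 : defect ≡ 0ℤ
  defect≡0 = vanish (φ 0 - σ · φ 0 - σ · φ (suc b) - σ · φ (suc c)) (1ℤ + -1ℤ ^ c) (1ℤ + -1ℤ ^ b)
                    opposite skewᵇ skewᶜ
    where
    vanish : ∀ {d₁ d₂ d₃} w x y → d₁ ≡ 0ℤ → d₂ ≡ 0ℤ → d₃ ≡ 0ℤ → d₁ · w + x · d₂ + y · d₃ ≡ 0ℤ
    vanish w x y refl refl refl = annihilate w x y
      where
      annihilate : ∀ w x y → 0ℤ · w + x · 0ℤ + y · 0ℤ ≡ 0ℤ
      annihilate = solve-∀

profileSum-corner : ∀ φ b c → -1ℤ ^ b ≡ -1ℤ → -1ℤ ^ c ≡ 1ℤ → profileSum φ 0 b c ≡ + 2 · φ b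
profileSum-corner φ b c b-odd c-even = begin
  profileSum φ 0 b c
    ≡⟨ cong₂ (λ x y → φ 0 · (x + y) + φ b · (y + 1ℤ) + φ c · (1ℤ + x)) b-odd c-even ⟩
  φ 0 · (-1ℤ + 1ℤ) + φ b · (1ℤ + 1ℤ) + φ c · (1ℤ + -1ℤ)
    ≡⟨ evaluate (φ 0) (φ b) (φ c) ⟩
  + 2 · φ b ∎
  where
  open ≡-Reasoning
  evaluate : ∀ z p q → z · (-1ℤ + 1ℤ) + p · (1ℤ + 1ℤ) + q · (1ℤ + -1ℤ) ≡ + 2 · p
  evaluate = solve-∀

-- Written with an accumulator so that Δ-up holds by computation.
crossing : (Tri → ℤ) → Tri → ℕ → (ℕ → Tri) → ℤ → ℤ
crossing f x zero    y acc = acc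
crossing f x (suc m) y acc = (f x - f (y m)) + acc

Δ-up : ∀ f i j k → let x = tri up i j k in
  Δ f x ≡ crossing f x i (λ m → tri down m j k)
            (crossing f x j (λ m → tri down i m k) (crossing f x k (tri down i j) 0ℤ))
Δ-up f zero    zero    zero    = refl
Δ-up f zero    zero    (suc k) = refl
Δ-up f zero    (suc j) zero    = refl
Δ-up f zero    (suc j) (suc k) = refl
Δ-up f (suc i) zero    zero    = refl
Δ-up f (suc i) zero    (suc k) = refl
Δ-up f (suc i) (suc j) zero    = refl
Δ-up f (suc i) (suc j) (suc k) = refl

crossing-ghost : ∀ f x m y acc (F : ℕ → ℤ) → (∀ m′ → f (y m′) ≡ F (suc m′)) →
  (m ≡ 0 → f x ≡ F 0) → crossing f x m y acc ≡ (f x - F m) + acc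
crossing-ghost f x zero y acc F _ ghost = begin
  acc                ≡⟨ sym (ℤ.+-identityˡ acc) ⟩
  0ℤ + acc           ≡⟨ cong (_+ acc) (sym (ℤ.+-inverseʳ (F 0))) ⟩
  (F 0 - F 0) + acc  ≡⟨ cong (λ v → (v - F 0) + acc) (sym (ghost refl)) ⟩
  (f x - F 0) + acc  ∎
  where open ≡-Reasoning
crossing-ghost f x (suc m) y acc F across _ = cong (λ v → (f x - v) + acc) (across m)

Δ-up-ghost : ∀ f (F : ℕ → ℕ → ℕ → ℤ) → (∀ a b c → f (tri down a b c) ≡ F (suc a) (suc b) (suc c)) →
  ∀ i j k → let x = tri up i j k in
  (i ≡ 0 → f x ≡ F 0 (suc j) (suc k)) → (j ≡ 0 → f x ≡ F (suc i) 0 (suc k)) →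
  (k ≡ 0 → f x ≡ F (suc i) (suc j) 0) →
  Δ f x ≡ (f x - F i (suc j) (suc k)) + ((f x - F (suc i) j (suc k)) + ((f x - F (suc i) (suc j) k) + 0ℤ))
Δ-up-ghost f F extends i j k ghostᵢ ghostⱼ ghostₖ =
  trans (Δ-up f i j k)
    (trans (crossing-ghost f x i (λ m → tri down m j k) _ (λ m → F m (suc j) (suc k))
              (λ m → extends m j k) ghostᵢ)
      (cong (_+_ (f x - F i (suc j) (suc k)))
        (trans (crossing-ghost f x j (λ m → tri down i m k) _ (λ m → F (suc i) m (suc k))
                  (λ m → extends i m k) ghostⱼ)
          (cong (_+_ (f x - F (suc i) j (suc k)))
            (crossing-ghost f x k (tri down i j) 0ℤ (F (suc i) (suc j)) (extends i j) ghostₖ)))))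
  where
  x : Tri
  x = tri up i j k

fromProfile : ℤ → (ℕ → ℤ) → Tri → ℤ
fromProfile σ φ (tri up   i j k) = profileSum φ i j k
fromProfile σ φ (tri down i j k) = - σ · profileSum φ (suc i) (suc j) (suc k)

fromProfile-invariant : ∀ n σ φ → Invariant n (fromProfile σ φ)
fromProfile-invariant n σ φ g (tri up   i j k) _ = pairSum-symmetric φ (-1ℤ ^_) g i j k
fromProfile-invariant n σ φ g (tri down i j k) _ =
  cong (- σ ·_) (pairSum-symmetric (φ ∘ suc) ((-1ℤ ^_) ∘ suc) g i j k)

balance-up : ∀ σ v A B C → v + A + B + C ≡ 0ℤ →
  (v - - σ · A) + ((v - - σ · B) + ((v - - σ · C) + 0ℤ)) ≡ (+ 3 - σ) · v
balance-up σ v A B C shifts≡0 = begin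
  (v - - σ · A) + ((v - - σ · B) + ((v - - σ · C) + 0ℤ)) ≡⟨ regroup σ v A B C ⟩
  (+ 3 - σ) · v + σ · (v + A + B + C)                    ≡⟨ cong (λ t → (+ 3 - σ) · v + σ · t) shifts≡0 ⟩
  (+ 3 - σ) · v + σ · 0ℤ                                 ≡⟨ drop σ ((+ 3 - σ) · v) ⟩
  (+ 3 - σ) · v                                          ∎
  where
  open ≡-Reasoning
  regroup : ∀ σ v A B C →
    (v - - σ · A) + ((v - - σ · B) + ((v - - σ · C) + 0ℤ)) ≡ (+ 3 - σ) · v + σ · (v + A + B + C)
  regroup = solve-∀
  drop : ∀ σ t → t + σ · 0ℤ ≡ t
  drop = solve-∀

balance-down : ∀ σ v A B C → σ · σ ≡ 1ℤ → v + A + B + C ≡ 0ℤ →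
  (- σ · v - A) + ((- σ · v - B) + ((- σ · v - C) + 0ℤ)) ≡ (+ 3 - σ) · (- σ · v)
balance-down σ v A B C σ²≡1 shifts≡0 = begin
  (- σ · v - A) + ((- σ · v - B) + ((- σ · v - C) + 0ℤ))   ≡⟨ regroup σ v A B C ⟩
  (+ 3 - σ) · (- σ · v) + ((1ℤ - σ · σ) · v - (v + A + B + C))
    ≡⟨ cong₂ (λ x y → (+ 3 - σ) · (- σ · v) + ((1ℤ - x) · v - y)) σ²≡1 shifts≡0 ⟩
  (+ 3 - σ) · (- σ · v) + 0ℤ                                ≡⟨ ℤ.+-identityʳ _ ⟩
  (+ 3 - σ) · (- σ · v)                                     ∎
  where
  open ≡-Reasoning
  regroup : ∀ σ v A B C →
    (- σ · v - A) + ((- σ · v - B) + ((- σ · v - C) + 0ℤ)) ≡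
    (+ 3 - σ) · (- σ · v) + ((1ℤ - σ · σ) · v - (v + A + B + C))
  regroup = solve-∀

fromProfile-eigen : ∀ {n σ φ} → σ · σ ≡ 1ℤ → -1ℤ ^ n ≡ 1ℤ → Skew n σ φ →
  EigenFn n (+ 3 - σ) (fromProfile σ φ)
fromProfile-eigen {n} {σ} {φ} _ n-even skew (tri up i j k) i+j+k+1≡n =
  trans (Δ-up-ghost (fromProfile σ φ) (λ a b c → - σ · profileSum φ a b c) (λ _ _ _ → refl)
           i j k ghostᵢ ghostⱼ ghostₖ)
        (balance-up σ (S i j k) (S i (suc j) (suc k)) (S (suc i) j (suc k)) (S (suc i) (suc j) k)
           (profileSum-evenShifts φ i j k))
  where
  open ≡-Reasoning
  S : ℕ → ℕ → ℕ → ℤ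
  S = profileSum φ
  boundary : ∀ b c → suc (b ℕ.+ c) ≡ n → S 0 b c ≡ - σ · S 0 (suc b) (suc c)
  boundary = profileSum-boundary {n} {σ} {φ} n-even skew
  ghostᵢ : i ≡ 0 → S i j k ≡ - σ · S 0 (suc j) (suc k)
  ghostᵢ refl = boundary j k i+j+k+1≡n
  ghostⱼ : j ≡ 0 → S i j k ≡ - σ · S (suc i) 0 (suc k)
  ghostⱼ refl = begin
    S i 0 k                    ≡⟨ pairSum-swap φ (-1ℤ ^_) 0 i k ⟩
    S 0 i k                    ≡⟨ boundary i k (trans (cong (λ t → suc (t ℕ.+ k)) (sym (ℕ.+-identityʳ i)))
                                                  i+j+k+1≡n) ⟩
    - σ · S 0 (suc i) (suc k)  ≡⟨ cong (- σ ·_) (pairSum-swap φ (-1ℤ ^_) (suc i) 0 (suc k)) ⟩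
    - σ · S (suc i) 0 (suc k)  ∎
  ghostₖ : k ≡ 0 → S i j k ≡ - σ · S (suc i) (suc j) 0
  ghostₖ refl = begin
    S i j 0                    ≡⟨ sym (pairSum-rotate φ (-1ℤ ^_) i j 0) ⟩
    S 0 i j                    ≡⟨ boundary i j (trans (cong suc (sym (ℕ.+-identityʳ (i ℕ.+ j)))) i+j+k+1≡n) ⟩
    - σ · S 0 (suc i) (suc j)  ≡⟨ cong (- σ ·_) (pairSum-rotate φ (-1ℤ ^_) (suc i) (suc j) 0) ⟩
    - σ · S (suc i) (suc j) 0  ∎
fromProfile-eigen {σ = σ} {φ} σ²≡1 _ _ (tri down i j k) _ =
  balance-down σ (S (suc i) (suc j) (suc k)) (S (suc i) j k) (S i (suc j) k) (S i j (suc k)) σ²≡1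
    (profileSum-oddShifts φ i j k)
  where
  S : ℕ → ℕ → ℕ → ℤ
  S = profileSum φ

δ : ℕ → ℕ → ℤ
δ a b = if does (a ℕ.≟ b) then 1ℤ else 0ℤ

δ-≡ : ∀ {a b} → a ≡ b → δ a b ≡ 1ℤ
δ-≡ {a} {b} a≡b = cong (if_then 1ℤ else 0ℤ) (dec-true (a ℕ.≟ b) a≡b)

δ-≢ : ∀ {a b} → a ≢ b → δ a b ≡ 0ℤ
δ-≢ {a} {b} a≢b = cong (if_then 1ℤ else 0ℤ) (dec-false (a ℕ.≟ b) a≢b)

δ-cong : ∀ {a b c d} → (a ≡ b) ⇔ (c ≡ d) → δ a b ≡ δ c d
δ-cong {a} {b} a≡b⇔c≡d with a ℕ.≟ b
... | yes a≡b = trans (δ-≡ a≡b) (sym (δ-≡ (Equivalence.to a≡b⇔c≡d a≡b)))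
... | no  a≢b = trans (δ-≢ a≢b) (sym (δ-≢ (a≢b ∘ Equivalence.from a≡b⇔c≡d)))

x+y≡n⇒[x≡z⇔y+z≡n] : ∀ {x y n z} → x ℕ.+ y ≡ n → (x ≡ z) ⇔ (y ℕ.+ z ≡ n)
x+y≡n⇒[x≡z⇔y+z≡n] {x} {y} x+y≡n = mk⇔
  (λ { refl → trans (ℕ.+-comm y x) x+y≡n })
  (λ y+z≡n → sym (ℕ.+-cancelˡ-≡ y _ _ (trans y+z≡n (trans (sym x+y≡n) (ℕ.+-comm x y)))))

δ-complement : ∀ {n} x y z → x ℕ.+ y ≡ n → δ x z ≡ δ (y ℕ.+ z) n
δ-complement {n} x y z x+y≡n = δ-cong {x} {z} {y ℕ.+ z} {n} (x+y≡n⇒[x≡z⇔y+z≡n] x+y≡n)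

-- δ_ρ − σ δ_(n−ρ), with x = n − ρ written as x + ρ = n to avoid truncated subtraction.
spike : ℕ → ℤ → ℕ → ℕ → ℤ
spike n σ ρ x = δ x ρ - σ · δ (x ℕ.+ ρ) n

spike-skew : ∀ {n σ} ρ → σ · σ ≡ 1ℤ → Skew n σ (spike n σ ρ)
spike-skew {n} {σ} ρ σ²≡1 x y x+y≡n = begin
  (δ x ρ - σ · δ (x ℕ.+ ρ) n) + σ · (δ y ρ - σ · δ (y ℕ.+ ρ) n)
    ≡⟨ cong₂ (λ a b → (a - σ · b) + σ · (δ y ρ - σ · δ (y ℕ.+ ρ) n))
             (δ-complement x y ρ x+y≡n) (sym (δ-complement y x ρ (trans (ℕ.+-comm y x) x+y≡n))) ⟩
  (δ (y ℕ.+ ρ) n - σ · δ y ρ) + σ · (δ y ρ - σ · δ (y ℕ.+ ρ) n)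
    ≡⟨ collect σ (δ (y ℕ.+ ρ) n) (δ y ρ) ⟩
  (1ℤ - σ · σ) · δ (y ℕ.+ ρ) n
    ≡⟨ cong (λ t → (1ℤ - t) · δ (y ℕ.+ ρ) n) σ²≡1 ⟩
  0ℤ ∎
  where
  open ≡-Reasoning
  collect : ∀ σ a b → (a - σ · b) + σ · (b - σ · a) ≡ (1ℤ - σ · σ) · a
  collect = solve-∀

spike-elsewhere : ∀ {n σ ρ x} → x ≢ ρ → x ℕ.+ ρ ≢ n → spike n σ ρ x ≡ 0ℤ
spike-elsewhere {σ = σ} x≢ρ x+ρ≢n =
  trans (cong₂ (λ a b → a - σ · b) (δ-≢ x≢ρ) (δ-≢ x+ρ≢n)) (cong (_-_ 0ℤ) (ℤ.*-zeroʳ σ))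

spike-self≢0 : ∀ {n σ ρ} → σ ≢ 1ℤ ⊎ ρ ℕ.+ ρ ≢ n → spike n σ ρ ρ ≢ 0ℤ
spike-self≢0 {n} {σ} {ρ} σ≢1∨2ρ≢n spike≡0 with ρ ℕ.+ ρ ℕ.≟ n | σ≢1∨2ρ≢n
... | yes 2ρ≡n | inj₂ 2ρ≢n = 2ρ≢n 2ρ≡n
... | yes 2ρ≡n | inj₁ σ≢1  = σ≢1 (sym (ℤ.i-j≡0⇒i≡j 1ℤ σ (begin
  1ℤ - σ                      ≡⟨ cong (_-_ 1ℤ) (sym (ℤ.*-identityʳ σ)) ⟩
  1ℤ - σ · 1ℤ                 ≡⟨ cong₂ (λ a b → a - σ · b) (sym (δ-≡ {ρ} refl)) (sym (δ-≡ 2ρ≡n)) ⟩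
  δ ρ ρ - σ · δ (ρ ℕ.+ ρ) n   ≡⟨ spike≡0 ⟩
  0ℤ                          ∎)))
  where open ≡-Reasoning
... | no 2ρ≢n  | _ = contradiction (begin
  1ℤ                          ≡⟨ cong (_-_ 1ℤ) (sym (ℤ.*-zeroʳ σ)) ⟩
  1ℤ - σ · 0ℤ                 ≡⟨ cong₂ (λ a b → a - σ · b) (sym (δ-≡ {ρ} refl)) (sym (δ-≢ 2ρ≢n)) ⟩
  δ ρ ρ - σ · δ (ρ ℕ.+ ρ) n   ≡⟨ spike≡0 ⟩
  0ℤ                          ∎) λ ()
  where open ≡-Reasoning

lincomb-vanishing : ∀ {m} c (u : Fin m → Tri → ℤ) x → (∀ t → u t x ≡ 0ℤ) → lincomb c u x ≡ 0ℤ
lincomb-vanishing {zero}  c u x _     = refl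
lincomb-vanishing {suc m} c u x u≡0 =
  cong₂ _+_ (trans (cong (c Fin.zero ·_) (u≡0 Fin.zero)) (ℤ.*-zeroʳ (c Fin.zero)))
            (lincomb-vanishing (c ∘ Fin.suc) (u ∘ Fin.suc) x (u≡0 ∘ Fin.suc))

lincomb-single : ∀ {m} c (u : Fin m → Tri → ℤ) x t → (∀ t′ → t′ ≢ t → u t′ x ≡ 0ℤ) →
  lincomb c u x ≡ c t · u t x
lincomb-single {suc m} c u x Fin.zero others≡0 =
  trans (cong (_+_ (c Fin.zero · u Fin.zero x))
          (lincomb-vanishing (c ∘ Fin.suc) (u ∘ Fin.suc) x (λ t → others≡0 (Fin.suc t) λ ())))
        (ℤ.+-identityʳ _)
lincomb-single {suc m} c u x (Fin.suc t) others≡0 =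
  trans (cong₂ _+_ (trans (cong (c Fin.zero ·_) (others≡0 Fin.zero λ ())) (ℤ.*-zeroʳ (c Fin.zero)))
                   (lincomb-single (c ∘ Fin.suc) (u ∘ Fin.suc) x t
                      (λ t′ t′≢t → others≡0 (Fin.suc t′) (t′≢t ∘ Fin.suc-injective))))
        (ℤ.+-identityˡ _)

linIndep-diagonal : ∀ {n m} {u : Fin m → Tri → ℤ} (y : Fin m → Tri) → (∀ t → Valid n (y t)) →
  (∀ i t → t ≢ i → u t (y i) ≡ 0ℤ) → (∀ t → u t (y t) ≢ 0ℤ) → LinIndep n u
linIndep-diagonal {u = u} y y-valid off-diagonal diagonal c combination≡0 t
  with ℤ.i*j≡0⇒i≡0∨j≡0 (c t)
         (trans (sym (lincomb-single c u (y t) t (off-diagonal t))) (combination≡0 (y t) (y-valid t)))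
... | inj₁ cₜ≡0      = cₜ≡0
... | inj₂ uₜ[yₜ]≡0 = contradiction uₜ[yₜ]≡0 (diagonal t)

2*n≡n+n : ∀ n → 2 * n ≡ n ℕ.+ n
2*n≡n+n n = cong (n ℕ.+_) (ℕ.+-identityʳ n)

m<n⇒m+m≢2*n : ∀ {m n} → m < n → m ℕ.+ m ≢ 2 * n
m<n⇒m+m≢2*n {m} {n} m<n m+m≡2n = ℕ.<⇒≢ (ℕ.+-mono-< m<n m<n) (trans m+m≡2n (2*n≡n+n n))

≤∧≤∧+≡2*⇒≡ : ∀ {a b n} → a ≤ n → b ≤ n → a ℕ.+ b ≡ 2 * n → a ≡ b
≤∧≤∧+≡2*⇒≡ {a} {b} {n} a≤n b≤n a+b≡2n =
  trans (≡n a≤n b≤n a+b≡2n) (sym (≡n b≤n a≤n (trans (ℕ.+-comm b a) a+b≡2n)))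
  where
  ≡n : ∀ {a b} → a ≤ n → b ≤ n → a ℕ.+ b ≡ 2 * n → a ≡ n
  ≡n a≤n b≤n a+b≡2n with ℕ.m≤n⇒m<n∨m≡n a≤n
  ... | inj₁ a<n = contradiction (trans a+b≡2n (2*n≡n+n n)) (ℕ.<⇒≢ (ℕ.+-mono-<-≤ a<n b≤n))
  ... | inj₂ a≡n = a≡n

m<⌊k/2⌋⇒2m+1<k : ∀ {m} k → m < ⌊ k /2⌋ → suc (2 * m) < k
m<⌊k/2⌋⇒2m+1<k {m} k m<k/2 = begin
  suc (suc (2 * m))        ≡⟨ ℕ.*-suc 2 m ⟨
  2 * suc m                ≤⟨ ℕ.*-monoʳ-≤ 2 m<k/2 ⟩
  2 * ⌊ k /2⌋              ≡⟨ 2*n≡n+n ⌊ k /2⌋ ⟩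
  ⌊ k /2⌋ ℕ.+ ⌊ k /2⌋      ≤⟨ ℕ.+-monoʳ-≤ ⌊ k /2⌋ (ℕ.⌊n/2⌋≤⌈n/2⌉ k) ⟩
  ⌊ k /2⌋ ℕ.+ ⌈ k /2⌉      ≡⟨ ℕ.⌊n/2⌋+⌈n/2⌉≡n k ⟩
  k                        ∎
  where open ℕ.≤-Reasoning

m<⌈k/2⌉⇒2m+1≤k : ∀ {m} k → m < ⌈ k /2⌉ → suc (2 * m) ≤ k
m<⌈k/2⌉⇒2m+1≤k k m<⌈k/2⌉ = ℕ.≤-pred (m<⌊k/2⌋⇒2m+1<k (suc k) m<⌈k/2⌉)

corner-valid : ∀ {k m} → suc (2 * m) ≤ k → Valid (2 * k) (tri up 0 (suc (2 * m)) (2 * (k ∸ suc m)))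
corner-valid {k} {m} 2m+1≤k = begin
  suc (suc (2 * m)) ℕ.+ 2 * (k ∸ suc m)  ≡⟨ cong (ℕ._+ 2 * (k ∸ suc m)) (ℕ.*-suc 2 m) ⟨
  2 * suc m ℕ.+ 2 * (k ∸ suc m)          ≡⟨ ℕ.*-distribˡ-+ 2 (suc m) (k ∸ suc m) ⟨
  2 * (suc m ℕ.+ (k ∸ suc m))            ≡⟨ cong (2 *_) (ℕ.m+[n∸m]≡n m+1≤k) ⟩
  2 * k                                  ∎
  where
  open ≡-Reasoning
  m+1≤k : suc m ≤ k
  m+1≤k = ℕ.≤-trans (ℕ.s≤s (ℕ.m≤m+n m (m ℕ.+ 0))) 2m+1≤k

spikeFamily : ∀ k σ M → σ · σ ≡ 1ℤ → (∀ (t : Fin M) → suc (2 * toℕ t) ≤ k) →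
  (∀ (t : Fin M) → σ ≢ 1ℤ ⊎ suc (2 * toℕ t) < k) → InvEigenDimAtLeast (2 * k) (+ 3 - σ) M
spikeFamily k σ M σ²≡1 ρ≤k σ≢1∨ρ<k =
  u , (λ t → fromProfile-invariant (2 * k) σ (φ t)) ,
  (λ t → fromProfile-eigen {2 * k} {σ} {φ t} σ²≡1 (-1^-even k) (spike-skew {2 * k} {σ} (ρ t) σ²≡1)) ,
  linIndep-diagonal {2 * k} y (λ t → corner-valid {k} {toℕ t} (ρ≤k t)) off-diagonal diagonal
  where
  ρ : Fin M → ℕ
  ρ t = suc (2 * toℕ t)
  φ : Fin M → ℕ → ℤ
  φ t = spike (2 * k) σ (ρ t)
  u : Fin M → Tri → ℤ
  u t = fromProfile σ (φ t)
  y : Fin M → Tri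
  y t = tri up 0 (ρ t) (2 * (k ∸ suc (toℕ t)))
  u[y] : ∀ i t → u t (y i) ≡ + 2 · φ t (ρ i)
  u[y] i t = profileSum-corner (φ t) (ρ i) (2 * (k ∸ suc (toℕ i)))
               (cong (-1ℤ ·_) (-1^-even (toℕ i))) (-1^-even (k ∸ suc (toℕ i)))
  off-diagonal : ∀ i t → t ≢ i → u t (y i) ≡ 0ℤ
  off-diagonal i t t≢i = trans (u[y] i t) (cong (_·_ (+ 2)) (spike-elsewhere {2 * k} {σ} ρᵢ≢ρₜ ρᵢ+ρₜ≢2k))
    where
    ρᵢ≢ρₜ : ρ i ≢ ρ t
    ρᵢ≢ρₜ = t≢i ∘ sym ∘ Fin.toℕ-injective ∘ ℕ.*-cancelˡ-≡ _ _ 2 ∘ ℕ.suc-injective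
    ρᵢ+ρₜ≢2k : ρ i ℕ.+ ρ t ≢ 2 * k
    ρᵢ+ρₜ≢2k = ρᵢ≢ρₜ ∘ ≤∧≤∧+≡2*⇒≡ (ρ≤k i) (ρ≤k t)
  diagonal : ∀ t → u t (y t) ≢ 0ℤ
  diagonal t u≡0 with ℤ.i*j≡0⇒i≡0∨j≡0 (+ 2) (trans (sym (u[y] t t)) u≡0)
  ... | inj₂ spike≡0 = spike-self≢0 {2 * k} {σ} {ρ t} (map₂ m<n⇒m+m≢2*n (σ≢1∨ρ<k t)) spike≡0

lemma5p1 : ∀ (k : ℕ) → 1 ≤ k →
    InvEigenDimAtLeast (2 * k) (+ 4) ⌈ k /2⌉ ×
    (2 ≤ k → InvEigenDimAtLeast (2 * k) (+ 2) ⌊ k /2⌋)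
lemma5p1 k _ =
  spikeFamily k -1ℤ ⌈ k /2⌉ refl (λ t → m<⌈k/2⌉⇒2m+1≤k k (Fin.toℕ<n t)) (λ _ → inj₁ λ ()) ,
  λ _ → spikeFamily k 1ℤ ⌊ k /2⌋ refl (λ t → ℕ.<⇒≤ (2m+1<k t)) (inj₂ ∘ 2m+1<k)
  where
  2m+1<k : ∀ (t : Fin ⌊ k /2⌋) → suc (2 * toℕ t) < k
  2m+1<k t = m<⌊k/2⌋⇒2m+1<k k (Fin.toℕ<n t)
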